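{- Let $\mathbf{M}$ be an $m\times n$ interval matrix with the strong Monge property. Then for every pair of rows $i<k$ and all integers $b,B$ with $1\le b<n-B+1\le n$ it holds that $$B\Big(\sum_{j=1}^{b}\overline{m}_{ij}\Big)-b\Big(\sum_{\ell=n-B+1}^{n}\underline{m}_{i\ell}\Big)\le B\Big(\sum_{j=1}^{b}\underline{m}_{kj}\Big)-b\Big(\sum_{\ell=n-B+1}^{n}\overline{m}_{k\ell}\Big).$$
   Context: An interval matrix $\mathbf{M}=[\underline{M},\overline{M}]$ with real $m\times n$ matrices $\underline{M}\le\overline{M}$ is the set $\{A\in\mathbb{R}^{m\times n}:\underline{M}\le A\le\overline{M}\}$ (entrywise), with entries $[\underline{m}_{ij},\overline{m}_{ij}]$. A real matrix $A$ is Monge if $a_{ij}+a_{k\ell}\le a_{i\ell}+a_{kj}$ for all $i<k$, $j<\ell$. An interval matrix has the strong Monge property if every real matrix it contains is Monge.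
   Formalization: The interval endpoints of $\mathbf{M}$ and the matrices quantified over in the strong Monge property have rational entries rather than real ones. -}

module Defs where

open import Data.Nat as ℕ using (ℕ)
open import Data.Integer as ℤ using (ℤ)
open import Data.Fin as Fin using (Fin; toℕ)
open import Data.Bool using (Bool; if_then_else_)
open import Data.List using (List; allFin; foldr)
open import Data.Rational using (ℚ; 0ℚ; _+_; _*_; _-_; _≤_; _/_)

-- Real m×n matrices are modelled as functions Fin m → Fin n → ℚ
-- (rows/columns 0-based; paper's index j corresponds to toℕ j + 1).
Matrix : ℕ → ℕ → Set
Matrix m n = Fin m → Fin n → ℚ

Monge : ∀ {m n} → Matrix m n → Set
Monge {m} {n} A = ∀ (i k : Fin m) (j ℓ : Fin n) → i Fin.< k → j Fin.< ℓ →
  A i j + A k ℓ ≤ A i ℓ + A k j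

record IntervalMatrix (m n : ℕ) : Set where
  field
    lower : Matrix m n
    upper : Matrix m n
    lower≤upper : ∀ i j → lower i j ≤ upper i j

open IntervalMatrix public

_∈ᴵ_ : ∀ {m n} → Matrix m n → IntervalMatrix m n → Set
A ∈ᴵ M = ∀ i j → lower M i j ≤ A i j × A i j ≤ upper M i j
  where open import Data.Product using (_×_)

StrongMonge : ∀ {m n} → IntervalMatrix m n → Set
StrongMonge {m} {n} M = ∀ (A : Matrix m n) → A ∈ᴵ M → Monge A

sumWhere : ∀ {n} → (ℕ → Bool) → (Fin n → ℚ) → ℚ
sumWhere {n} p f = foldr (λ j acc → (if p (toℕ j) then f j else 0ℚ) + acc) 0ℚ (allFin n)

-- Paper's Σ_{j=1}^{b} f j   (0-based: toℕ j < b)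
sumFirst : ∀ {n} → ℕ → (Fin n → ℚ) → ℚ
sumFirst b f = sumWhere (λ t → t ℕ.<ᵇ b) f

-- Paper's Σ_{ℓ=n-B+1}^{n} f ℓ   (0-based: n ∸ B ≤ toℕ ℓ)
sumLast : ∀ {n} → ℕ → (Fin n → ℚ) → ℚ
sumLast {n} B f = sumWhere (λ t → (n ℕ.∸ B) ℕ.≤ᵇ t) f

ι : ℕ → ℚ
ι k = ℤ.+ k / 1

{-# OPTIONS --safe #-}
-- If j is among the first b columns and ℓ among the last B, then j < ℓ, and a member of M
-- that is upper at (i, j), (k, ℓ) and lower at (i, ℓ), (k, j) is Monge; hence
-- m̄ᵢⱼ + m̄ₖℓ ≤ m̲ᵢℓ + m̲ₖⱼ.  Summing over all b·B such pairs gives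
-- B Σⱼ m̄ᵢⱼ + b Σℓ m̄ₖℓ ≤ b Σℓ m̲ᵢℓ + B Σⱼ m̲ₖⱼ, which rearranges to the claim.
module Submission where

open import Defs
open import Data.Nat as ℕ using (ℕ; zero; suc)
open import Data.Fin as Fin using (Fin; toℕ)
open import Data.Rational using (_*_; _-_; _≤_)

import Data.Nat.Properties as ℕP
import Data.Fin.Properties as FinP
import Data.Integer as ℤ
import Data.Integer.Properties as ℤP
import Data.Nat.Coprimality as Coprime
open import Data.Rational using (ℚ; 0ℚ; 1ℚ; _+_; -_; mkℚ)
import Data.Rational.Properties as ℚP
open import Data.Rational.Solver using (module +-*-Solver)
open import Algebra.Bundles using (CommutativeMonoid)
open import Algebra.Properties.CommutativeSemigroup
  (CommutativeMonoid.commutativeSemigroup ℚP.+-0-commutativeMonoid) using (interchange)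
open import Data.Bool using (Bool; true; false; if_then_else_; not; _xor_; T)
open import Data.List using (List; []; _∷_; foldr; map; tabulate; allFin)
import Data.List.Properties as List
open import Data.Product using (_,_)
open import Function using (id; _∘_)
open import Relation.Nullary using (does)
open import Relation.Nullary.Decidable using (dec-true; dec-false)
open import Relation.Binary.PropositionalEquality
  using (_≡_; _≢_; refl; sym; cong; cong₂; trans; subst; subst₂; module ≡-Reasoning)

-- ι k is the normalisation of the already normal fraction k/1, on which ℚ's addition computes.
ι-suc : ∀ k → ι (suc k) ≡ 1ℚ + ι k
ι-suc k = sym (begin
  1ℚ + ι k    ≡⟨ cong (1ℚ +_) (ℚP.↥p/↧p≡p k/1) ⟩
  1ℚ + k/1    ≡⟨ ℚP./-cong (cong (ℤ._+_ (ℤ.+ 1)) (ℤP.*-identityʳ (ℤ.+ k))) refl ⟩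
  ι (suc k)   ∎)
  where
  open ≡-Reasoning
  k/1 : ℚ
  k/1 = mkℚ (ℤ.+ k) 0 (Coprime.sym (Coprime.1-coprimeTo k))

-- Defs.sumWhere p f is definitionally filteredSum (p ∘ toℕ) f (allFin n).
filteredSum : ∀ {A : Set} → (A → Bool) → (A → ℚ) → List A → ℚ
filteredSum q f = foldr (λ x acc → (if q x then f x else 0ℚ) + acc) 0ℚ

count : ∀ {A : Set} → (A → Bool) → List A → ℚ
count q = filteredSum q (λ _ → 1ℚ)

module _ {A : Set} where

  filteredSum-mono : ∀ (q : A → Bool) {f g} → (∀ x → T (q x) → f x ≤ g x) →
                     ∀ xs → filteredSum q f xs ≤ filteredSum q g xs
  filteredSum-mono q f≤g []       = ℚP.≤-refl
  filteredSum-mono q f≤g (x ∷ xs) = ℚP.+-mono-≤ (head-mono (q x) (f≤g x)) (filteredSum-mono q f≤g xs)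
    where
    head-mono : ∀ b {y z} → (T b → y ≤ z) → (if b then y else 0ℚ) ≤ (if b then z else 0ℚ)
    head-mono true  y≤z = y≤z _
    head-mono false _   = ℚP.≤-refl

  filteredSum-+ : ∀ (q : A → Bool) f g xs →
                  filteredSum q (λ x → f x + g x) xs ≡ filteredSum q f xs + filteredSum q g xs
  filteredSum-+ q f g []       = sym (ℚP.+-identityˡ 0ℚ)
  filteredSum-+ q f g (x ∷ xs) = trans
    (cong₂ _+_ (if-+ (q x)) (filteredSum-+ q f g xs))
    (interchange (if q x then f x else 0ℚ) (if q x then g x else 0ℚ) (filteredSum q f xs) (filteredSum q g xs))
    where
    if-+ : ∀ b → (if b then f x + g x else 0ℚ) ≡ (if b then f x else 0ℚ) + (if b then g x else 0ℚ)
    if-+ true  = refl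
    if-+ false = sym (ℚP.+-identityˡ 0ℚ)

  filteredSum-mono-+ : ∀ (q : A → Bool) {f g h k} → (∀ x → T (q x) → f x + g x ≤ h x + k x) → ∀ xs →
                       filteredSum q f xs + filteredSum q g xs ≤ filteredSum q h xs + filteredSum q k xs
  filteredSum-mono-+ q {f} {g} {h} {k} f+g≤h+k xs =
    subst₂ _≤_ (filteredSum-+ q f g xs) (filteredSum-+ q h k xs) (filteredSum-mono q f+g≤h+k xs)

  filteredSum-*ˡ : ∀ (q : A → Bool) c f xs → filteredSum q (λ x → c * f x) xs ≡ c * filteredSum q f xs
  filteredSum-*ˡ q c f []       = sym (ℚP.*-zeroʳ c)
  filteredSum-*ˡ q c f (x ∷ xs) = trans
    (cong₂ _+_ (if-* (q x)) (filteredSum-*ˡ q c f xs))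
    (sym (ℚP.*-distribˡ-+ c (if q x then f x else 0ℚ) (filteredSum q f xs)))
    where
    if-* : ∀ b → (if b then c * f x else 0ℚ) ≡ c * (if b then f x else 0ℚ)
    if-* true  = refl
    if-* false = sym (ℚP.*-zeroʳ c)

  filteredSum-const : ∀ (q : A → Bool) c xs → filteredSum q (λ _ → c) xs ≡ count q xs * c
  filteredSum-const q c []       = sym (ℚP.*-zeroˡ c)
  filteredSum-const q c (x ∷ xs) = trans
    (cong₂ _+_ (if-const (q x)) (filteredSum-const q c xs))
    (sym (ℚP.*-distribʳ-+ c (if q x then 1ℚ else 0ℚ) (count q xs)))
    where
    if-const : ∀ b → (if b then c else 0ℚ) ≡ (if b then 1ℚ else 0ℚ) * c
    if-const true  = sym (ℚP.*-identityˡ c)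
    if-const false = sym (ℚP.*-zeroˡ c)

  filteredSum-cong : ∀ {p q : A → Bool} f → (∀ x → p x ≡ q x) → ∀ xs → filteredSum p f xs ≡ filteredSum q f xs
  filteredSum-cong f p≡q []       = refl
  filteredSum-cong f p≡q (x ∷ xs) =
    cong₂ (λ b s → (if b then f x else 0ℚ) + s) (p≡q x) (filteredSum-cong f p≡q xs)

filteredSum-map : ∀ {A B : Set} (g : A → B) (q : B → Bool) f xs →
                  filteredSum q f (map g xs) ≡ filteredSum (q ∘ g) (f ∘ g) xs
filteredSum-map g q f []       = refl
filteredSum-map g q f (x ∷ xs) = cong (_+_ (if q (g x) then f (g x) else 0ℚ)) (filteredSum-map g q f xs)

filteredSum-separable : ∀ {A B : Set} (p : A → Bool) (q : B → Bool) {f : A → ℚ} {g h : B → ℚ} {k : A → ℚ} →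
  (∀ x y → T (p x) → T (q y) → f x + g y ≤ h y + k x) → ∀ xs ys →
  count q ys * filteredSum p f xs + count p xs * filteredSum q g ys
    ≤ count p xs * filteredSum q h ys + count q ys * filteredSum p k xs
filteredSum-separable p q {f} {g} {h} {k} f+g≤h+k xs ys = begin
  count q ys * filteredSum p f xs + count p xs * filteredSum q g ys
    ≡⟨ cong₂ _+_ (filteredSum-*ˡ p (count q ys) f xs) (filteredSum-const p (filteredSum q g ys) xs) ⟨
  filteredSum p (λ x → count q ys * f x) xs + filteredSum p (λ _ → filteredSum q g ys) xs
    ≤⟨ filteredSum-mono-+ p row xs ⟩
  filteredSum p (λ _ → filteredSum q h ys) xs + filteredSum p (λ x → count q ys * k x) xs
    ≡⟨ cong₂ _+_ (filteredSum-const p (filteredSum q h ys) xs) (filteredSum-*ˡ p (count q ys) k xs) ⟩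
  count p xs * filteredSum q h ys + count q ys * filteredSum p k xs ∎
  where
  open ℚP.≤-Reasoning
  row : ∀ x → T (p x) → count q ys * f x + filteredSum q g ys ≤ filteredSum q h ys + count q ys * k x
  row x px = begin
    count q ys * f x + filteredSum q g ys                ≡⟨ cong (_+ filteredSum q g ys) (filteredSum-const q (f x) ys) ⟨
    filteredSum q (λ _ → f x) ys + filteredSum q g ys    ≤⟨ filteredSum-mono-+ q (λ y → f+g≤h+k x y px) ys ⟩
    filteredSum q h ys + filteredSum q (λ _ → k x) ys    ≡⟨ cong (filteredSum q h ys +_) (filteredSum-const q (k x) ys) ⟩
    filteredSum q h ys + count q ys * k x                ∎

count-allFin-suc : ∀ n (q : Fin (suc n) → Bool) →
  count q (allFin (suc n)) ≡ (if q Fin.zero then 1ℚ else 0ℚ) + count (q ∘ Fin.suc) (allFin n)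
count-allFin-suc n q = cong ((if q Fin.zero then 1ℚ else 0ℚ) +_) (begin
  count q (tabulate Fin.suc)           ≡⟨ cong (count q) (List.map-tabulate id Fin.suc) ⟨
  count q (map Fin.suc (allFin n))     ≡⟨ filteredSum-map Fin.suc q (λ _ → 1ℚ) (allFin n) ⟩
  count (q ∘ Fin.suc) (allFin n)       ∎)
  where open ≡-Reasoning

count-allFin-<ᵇ : ∀ {n b} → b ℕ.≤ n → count (λ j → toℕ j ℕ.<ᵇ b) (allFin n) ≡ ι b
count-allFin-<ᵇ {zero}  ℕ.z≤n = refl
count-allFin-<ᵇ {suc n} ℕ.z≤n = trans (count-allFin-suc n (λ j → toℕ j ℕ.<ᵇ 0))
  (trans (ℚP.+-identityˡ _) (count-allFin-<ᵇ {n} ℕ.z≤n))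
count-allFin-<ᵇ {suc n} {suc b} (ℕ.s≤s b≤n) = trans (count-allFin-suc n (λ j → toℕ j ℕ.<ᵇ suc b))
  (trans (cong (1ℚ +_) (count-allFin-<ᵇ b≤n)) (sym (ι-suc b)))

count-allFin-≤ᵇ : ∀ n s → count (λ j → s ℕ.≤ᵇ toℕ j) (allFin n) ≡ ι (n ℕ.∸ s)
count-allFin-≤ᵇ zero    s       = cong ι (sym (ℕP.0∸n≡0 s))
count-allFin-≤ᵇ (suc n) zero    = trans (count-allFin-suc n (λ j → 0 ℕ.≤ᵇ toℕ j))
  (trans (cong (1ℚ +_) (count-allFin-≤ᵇ n zero)) (sym (ι-suc n)))
count-allFin-≤ᵇ (suc n) (suc s) = trans (count-allFin-suc n (λ j → suc s ℕ.≤ᵇ toℕ j))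
  (trans (ℚP.+-identityˡ _)
  (trans (filteredSum-cong _ (λ j → suc-≤ᵇ-suc s (toℕ j)) (allFin n)) (count-allFin-≤ᵇ n s)))
  where
  suc-≤ᵇ-suc : ∀ s t → (suc s ℕ.≤ᵇ suc t) ≡ (s ℕ.≤ᵇ t)
  suc-≤ᵇ-suc zero    t = refl
  suc-≤ᵇ-suc (suc s) t = refl

p+s≤q+r⇒p-q≤r-s : ∀ p q r s → p + s ≤ q + r → p - q ≤ r - s
p+s≤q+r⇒p-q≤r-s p q r s p+s≤q+r =
  subst₂ _≤_ (cancelˡ p q s) (cancelʳ q r s) (ℚP.+-monoˡ-≤ (- q - s) p+s≤q+r)
  where
  open +-*-Solver
  cancelˡ : ∀ p q s → (p + s) + (- q - s) ≡ p - q
  cancelˡ = solve 3 (λ p q s → (p :+ s) :+ (:- q :- s) := p :- q) refl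
  cancelʳ : ∀ q r s → (q + r) + (- q - s) ≡ r - s
  cancelʳ = solve 3 (λ q r s → (q :+ r) :+ (:- q :- s) := r :- s) refl

module _ {m n} (M : IntervalMatrix m n) where

  pick : (Fin m → Fin n → Bool) → Matrix m n
  pick s r c = if s r c then upper M r c else lower M r c

  pick-∈ᴵ : ∀ s → pick s ∈ᴵ M
  pick-∈ᴵ s r c with s r c
  ... | true  = lower≤upper M r c , ℚP.≤-refl
  ... | false = ℚP.≤-refl , lower≤upper M r c

  strongMonge⇒corner : StrongMonge M → ∀ {i k j ℓ} → i Fin.< k → j Fin.< ℓ →
                       upper M i j + upper M k ℓ ≤ lower M i ℓ + lower M k j
  strongMonge⇒corner SM {i} {k} {j} {ℓ} i<k j<ℓ = subst₂ _≤_
    (cong₂ _+_ (entry i j (dec-true (i Fin.≟ i) refl) (dec-true (j Fin.≟ j) refl))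
               (entry k ℓ (dec-false (k Fin.≟ i) k≢i) (dec-false (ℓ Fin.≟ j) ℓ≢j)))
    (cong₂ _+_ (entry i ℓ (dec-true (i Fin.≟ i) refl) (dec-false (ℓ Fin.≟ j) ℓ≢j))
               (entry k j (dec-false (k Fin.≟ i) k≢i) (dec-true (j Fin.≟ j) refl)))
    (SM (pick diagonal) (pick-∈ᴵ diagonal) i k j ℓ i<k j<ℓ)
    where
    -- On the rectangle {i, k} × {j, ℓ} this selects exactly the diagonal (i, j), (k, ℓ).
    diagonal : Fin m → Fin n → Bool
    diagonal r c = not (does (r Fin.≟ i) xor does (c Fin.≟ j))

    entry : ∀ r c {a b} → does (r Fin.≟ i) ≡ a → does (c Fin.≟ j) ≡ b →
            pick diagonal r c ≡ (if not (a xor b) then upper M r c else lower M r c)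
    entry r c refl refl = refl

    k≢i : k ≢ i
    k≢i = FinP.<⇒≢ i<k ∘ sym

    ℓ≢j : ℓ ≢ j
    ℓ≢j = FinP.<⇒≢ j<ℓ ∘ sym

lemma6p3 : ∀ {m n} (M : IntervalMatrix m n) → StrongMonge M →
    ∀ (i k : Fin m) → i Fin.< k →
    ∀ (b B : ℕ) → 1 ℕ.≤ b → b ℕ.< (n ℕ.∸ B) ℕ.+ 1 → B ℕ.≤ n → (n ℕ.∸ B) ℕ.+ 1 ℕ.≤ n →
      ι B * sumFirst b (upper M i) - ι b * sumLast B (lower M i)
        ≤ ι B * sumFirst b (lower M k) - ι b * sumLast B (upper M k)
lemma6p3 {n = n} M SM i k i<k b B _ b<n∸B+1 B≤n _ =
  p+s≤q+r⇒p-q≤r-s firstUᵢ lastLᵢ firstLₖ lastUₖ summed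
  where
  first last : Fin n → Bool
  first j = toℕ j ℕ.<ᵇ b
  last  ℓ = (n ℕ.∸ B) ℕ.≤ᵇ toℕ ℓ

  b≤n∸B : b ℕ.≤ n ℕ.∸ B
  b≤n∸B = ℕP.m<1+n⇒m≤n (subst (b ℕ.<_) (ℕP.+-comm (n ℕ.∸ B) 1) b<n∸B+1)

  corner : ∀ j ℓ → T (first j) → T (last ℓ) →
           upper M i j + upper M k ℓ ≤ lower M i ℓ + lower M k j
  corner j ℓ j-first ℓ-last = strongMonge⇒corner M SM i<k
    (ℕP.<-≤-trans (ℕP.<ᵇ⇒< _ b j-first) (ℕP.≤-trans b≤n∸B (ℕP.≤ᵇ⇒≤ _ _ ℓ-last)))

  #first : count first (allFin n) ≡ ι b
  #first = count-allFin-<ᵇ (ℕP.≤-trans b≤n∸B (ℕP.m∸n≤m n B))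

  #last : count last (allFin n) ≡ ι B
  #last = trans (count-allFin-≤ᵇ n (n ℕ.∸ B)) (cong ι (ℕP.m∸[m∸n]≡n B≤n))

  firstUᵢ lastLᵢ firstLₖ lastUₖ : ℚ
  firstUᵢ = ι B * sumFirst b (upper M i)
  lastLᵢ  = ι b * sumLast B (lower M i)
  firstLₖ = ι B * sumFirst b (lower M k)
  lastUₖ  = ι b * sumLast B (upper M k)

  summed : firstUᵢ + lastUₖ ≤ lastLᵢ + firstLₖ
  summed = subst₂ (λ #l #f → #l * sumFirst b (upper M i) + #f * sumLast B (upper M k)
                               ≤ #f * sumLast B (lower M i) + #l * sumFirst b (lower M k))
    #last #first
    (filteredSum-separable first last {f = upper M i} {upper M k} {lower M i} {lower M k}
      corner (allFin n) (allFin n))
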